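{- Let $p$ be a prime and $\varphi$ a support map of length $\ell$ whose jumps are all at most $M$. Then $\varphi(i)\leq \frac{M}{p-1}$ for every $i\in\mathbb{Z}/\ell\mathbb{Z}$.
   Context: A map $\varphi:\mathbb{Z}/\ell\mathbb{Z}\to\mathbb{Z}_{>0}$ is a support map of length $\ell$ with $s$ jumps ($\ell\geq s$) if $\varphi(i+1)=p\varphi(i)$ for all $i$ except exactly $s$ pairwise distinct values $i_1,\dots,i_s$, for which $\varphi(i+1)<p\varphi(i)$. The jumps of $\varphi$ are the positive integers $p\varphi(i_t)-\varphi(i_t+1)$, $1\leq t\leq s$. -}

module Defs where

open import Data.Nat using (ℕ; suc; _*_; _∸_; _<_; _≤_; NonZero)
open import Data.Nat.DivMod using (_mod_)
open import Data.Fin using (Fin; toℕ)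
open import Data.Fin.Subset using (Subset; _∈_; _∉_; ∣_∣)
open import Data.Product using (Σ; _×_)
open import Relation.Binary.PropositionalEquality using (_≡_)

-- successor map i ↦ i + 1 on ℤ/ℓℤ, represented as Fin ℓ
next : ∀ {ℓ} .{{_ : NonZero ℓ}} → Fin ℓ → Fin ℓ
next {ℓ} i = suc (toℕ i) mod ℓ

record IsSupportMapWithJumps (p ℓ s : ℕ) .{{_ : NonZero ℓ}}
                             (φ : Fin ℓ → ℕ) (J : Subset ℓ) : Set where
  field
    positive   : ∀ i → 0 < φ i
    s≤ℓ        : s ≤ ℓ
    card       : ∣ J ∣ ≡ s
    nonjump    : ∀ i → i ∉ J → φ (next i) ≡ p * φ i
    jump       : ∀ i → i ∈ J → φ (next i) < p * φ i

IsSupportMap : (p ℓ s : ℕ) .{{_ : NonZero ℓ}} → (Fin ℓ → ℕ) → Set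
IsSupportMap p ℓ s φ = Σ (Subset ℓ) (IsSupportMapWithJumps p ℓ s φ)

jumpAt : ∀ {ℓ} .{{_ : NonZero ℓ}} → ℕ → (Fin ℓ → ℕ) → Fin ℓ → ℕ
jumpAt p φ i = p * φ i ∸ φ (next i)

{-# OPTIONS --safe #-}
module Submission where

-- Let m be a point where φ is maximal. Every jump is at most M, and at a non-jump position the
-- "jump" p φ(i) − φ(i+1) is 0, so p φ(m) − φ(m+1) ≤ M everywhere. Since φ(m+1) ≤ φ(m),
-- (p − 1) φ(i) ≤ (p − 1) φ(m) = p φ(m) − φ(m) ≤ p φ(m) − φ(m+1) ≤ M.

open import Defs
open import Data.Nat using (ℕ; _*_; _∸_; _≤_; z≤n; NonZero)
open import Data.Nat.Properties
  using (≤-trans; ≤-totalOrder; *-monoʳ-≤; ∸-monoʳ-≤; *-distribʳ-∸; *-identityˡ; n∸n≡0)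
open import Data.Nat.Primality using (Prime)
open import Data.Fin using (Fin)
open import Data.Fin.Subset using (Subset; _∈_)
open import Data.Fin.Subset.Properties using (_∈?_)
open import Data.List using (allFin)
open import Data.List.Relation.Unary.All using (lookup)
open import Data.List.Membership.Propositional.Properties using (∈-allFin)
open import Data.List.Extrema ≤-totalOrder using (argmax; f[xs]≤f[argmax])
open import Data.Product using (Σ; _,_)
open import Relation.Nullary using (yes; no)
open import Relation.Binary.PropositionalEquality using (_≡_; sym; subst; cong; module ≡-Reasoning)

module _ {ℓ : ℕ} .{{_ : NonZero ℓ}} (p : ℕ) (φ : Fin ℓ → ℕ) where

  jumpAt≡0 : ∀ i → φ (next i) ≡ p * φ i → jumpAt p φ i ≡ 0
  jumpAt≡0 i eq = subst (λ x → p * φ i ∸ x ≡ 0) (sym eq) (n∸n≡0 (p * φ i))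

  pred*≤jumpAt : ∀ i → φ (next i) ≤ φ i → (p ∸ 1) * φ i ≤ jumpAt p φ i
  pred*≤jumpAt i φ[i+1]≤φ[i] =
    subst (_≤ jumpAt p φ i) (sym pred*φ[i]≡) (∸-monoʳ-≤ (p * φ i) φ[i+1]≤φ[i])
    where
    open ≡-Reasoning
    pred*φ[i]≡ : (p ∸ 1) * φ i ≡ p * φ i ∸ φ i
    pred*φ[i]≡ = begin
      (p ∸ 1) * φ i        ≡⟨ *-distribʳ-∸ (φ i) p 1 ⟩
      p * φ i ∸ 1 * φ i    ≡⟨ cong (p * φ i ∸_) (*-identityˡ (φ i)) ⟩
      p * φ i ∸ φ i        ∎

  jumpAt≤-everywhere : ∀ {s M J} → IsSupportMapWithJumps p ℓ s φ J →
                       (∀ i → i ∈ J → jumpAt p φ i ≤ M) → ∀ i → jumpAt p φ i ≤ M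
  jumpAt≤-everywhere {M = M} {J} H jumps≤M i with i ∈? J
  ... | yes i∈J = jumps≤M i i∈J
  ... | no  i∉J = subst (_≤ M) (sym (jumpAt≡0 i (IsSupportMapWithJumps.nonjump H i i∉J))) z≤n

maximum-attained : ∀ {ℓ} (f : Fin ℓ → ℕ) → Fin ℓ → Σ (Fin ℓ) λ m → ∀ j → f j ≤ f m
maximum-attained {ℓ} f i =
  argmax f i (allFin ℓ) , λ j → lookup (f[xs]≤f[argmax] {f = f} i (allFin ℓ)) (∈-allFin j)

lemma1p5 : (p ℓ s M : ℕ) .{{_ : NonZero ℓ}} → Prime p →
           (φ : Fin ℓ → ℕ) → (J : Subset ℓ) → (H : IsSupportMapWithJumps p ℓ s φ J) →
           (∀ i → i ∈ J → jumpAt p φ i ≤ M) →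
           ∀ i → (p ∸ 1) * φ i ≤ M
lemma1p5 p ℓ s M _ φ J H jumps≤M i with maximum-attained φ i
... | m , φ≤φ[m] =
  ≤-trans (*-monoʳ-≤ (p ∸ 1) (φ≤φ[m] i))
    (≤-trans (pred*≤jumpAt p φ m (φ≤φ[m] (next m))) (jumpAt≤-everywhere p φ H jumps≤M m))
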